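{- Let $M$ and $M'$ be closed terms of $\mathsf{pCBPV}$ with $\vdash M:1$ and $\vdash M':1$. If $M\rightsquigarrow M'$ (one deterministic weak reduction step), then $\mathrm{Red}^\infty_{M,()}=\mathrm{Red}^\infty_{M',()}$.
   Context: $\mathsf{pCBPV}$ terms: $x\mid()\mid\mathrm{stop}(M)\mid\langle M,N\rangle\mid\mathrm{in}_\ell M\mid\mathrm{in}_rM\mid\lambda x^\phi.M\mid\langle M\rangle N\mid\mathrm{case}(M,x_\ell\cdot N_\ell,x_r\cdot N_r)\mid\mathrm{pr}_\ell M\mid\mathrm{pr}_rM\mid\mathrm{go}(M)\mid\mathrm{fix}\,x^\sigma.M\mid\mathrm{fold}(M)\mid\mathrm{unfold}(M)\mid\mathrm{coin}(p)$, $p\in[0,1]\cap\mathbb Q$, typed with positive types $\phi::=1\mid\,!\sigma\mid\phi\otimes\psi\mid\phi\oplus\psi\mid\zeta\mid\mu\zeta.\phi$ and general types $\sigma::=\phi\mid\phi\multimap\sigma$ (in particular $():1$ and $\mathrm{coin}(p):1\oplus1$). Values $V,W::=x\mid()\mid\mathrm{stop}(M)\mid\langle V,W\rangle\mid\mathrm{in}_iV\mid\mathrm{fold}(V)$. Weak reduction $\rightsquigarrow$ is given by the axioms $\mathrm{go}(\mathrm{stop}(M))\rightsquigarrow M$; $\langle\lambda x^\phi.M\rangle V\rightsquigarrow M[V/x]$; $\mathrm{pr}_i\langle V_\ell,V_r\rangle\rightsquigarrow V_i$; $\mathrm{fix}\,x^\sigma.M\rightsquigarrow M[\mathrm{stop}(\mathrm{fix}\,x^\sigma.M)/x]$;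 $\mathrm{case}(\mathrm{in}_iV,x_\ell\cdot M_\ell,x_r\cdot M_r)\rightsquigarrow M_i[V/x_i]$; $\mathrm{unfold}(\mathrm{fold}(V))\rightsquigarrow V$. Probabilistic reduction $M\to_pM'$: if $M\rightsquigarrow M'$ then $M\to_1M'$; $\mathrm{coin}(p)\to_p\mathrm{in}_\ell()$ and $\mathrm{coin}(p)\to_{1-p}\mathrm{in}_r()$; and if $M\to_pM'$ then $\mathrm{go}(M)\to_p\mathrm{go}(M')$, $\langle M\rangle V\to_p\langle M'\rangle V$ for $V$ a value, $\langle N\rangle M\to_p\langle N\rangle M'$, $\mathrm{pr}_iM\to_p\mathrm{pr}_iM'$, $\langle M,N\rangle\to_p\langle M',N\rangle$, $\langle V,M\rangle\to_p\langle V,M'\rangle$, $\mathrm{in}_iM\to_p\mathrm{in}_iM'$, $\mathrm{case}(M,x_\ell\cdot N_\ell,x_r\cdot N_r)\to_p\mathrm{case}(M',x_\ell\cdot N_\ell,x_r\cdot N_r)$, $\mathrm{fold}(M)\to_p\mathrm{fold}(M')$, $\mathrm{unfold}(M)\to_p\mathrm{unfold}(M')$. A term is weak normal if it has no $\to_p$ reduct. $\mathrm{Red}_{M,M'}=p$ if $M\to_pM'$, $1$ if $M$ is weak normal and $M'=M$, $0$ otherwise; $\mathrm{Red}^\infty_{M,M'}=\sup_n(\mathrm{Red}^n)_{M,M'}$ if $M'$ is weak normal and $0$ otherwise. -}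

module Defs where

open import Data.Nat using (ℕ; zero; suc)
open import Data.Fin using (Fin; zero; suc)
open import Data.Vec using (Vec; _∷_; []; lookup)
open import Data.List using (List; []; _∷_; map; concatMap; foldr)
open import Data.Maybe using (Maybe; just; nothing; fromMaybe)
import Data.Maybe as Maybe
open import Data.Bool using (Bool; true; false; _∧_; if_then_else_; T)
open import Data.Product using (_×_; _,_; ∃-syntax)
open import Data.Rational using (ℚ; 0ℚ; 1ℚ; _+_; _*_; _-_; _≤_; _<_)

mutual
  data PTy (k : ℕ) : Set where
    one  : PTy k
    bang : GTy k → PTy k
    _⊗_  : PTy k → PTy k → PTy k
    _⊕_  : PTy k → PTy k → PTy k
    tvar : Fin k → PTy k
    mu   : PTy (suc k) → PTy k

  data GTy (k : ℕ) : Set where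
    pos : PTy k → GTy k
    _⊸_ : PTy k → GTy k → GTy k

extT : ∀ {k l} → (Fin k → Fin l) → Fin (suc k) → Fin (suc l)
extT ρ zero = zero
extT ρ (suc i) = suc (ρ i)

mutual
  renP : ∀ {k l} → (Fin k → Fin l) → PTy k → PTy l
  renP ρ one = one
  renP ρ (bang σ) = bang (renG ρ σ)
  renP ρ (φ ⊗ ψ) = renP ρ φ ⊗ renP ρ ψ
  renP ρ (φ ⊕ ψ) = renP ρ φ ⊕ renP ρ ψ
  renP ρ (tvar i) = tvar (ρ i)
  renP ρ (mu φ) = mu (renP (extT ρ) φ)

  renG : ∀ {k l} → (Fin k → Fin l) → GTy k → GTy l
  renG ρ (pos φ) = pos (renP ρ φ)
  renG ρ (φ ⊸ σ) = renP ρ φ ⊸ renG ρ σ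

extsT : ∀ {k l} → (Fin k → PTy l) → Fin (suc k) → PTy (suc l)
extsT s zero = tvar zero
extsT s (suc i) = renP suc (s i)

mutual
  subP : ∀ {k l} → (Fin k → PTy l) → PTy k → PTy l
  subP s one = one
  subP s (bang σ) = bang (subG s σ)
  subP s (φ ⊗ ψ) = subP s φ ⊗ subP s ψ
  subP s (φ ⊕ ψ) = subP s φ ⊕ subP s ψ
  subP s (tvar i) = s i
  subP s (mu φ) = mu (subP (extsT s) φ)

  subG : ∀ {k l} → (Fin k → PTy l) → GTy k → GTy l
  subG s (pos φ) = pos (subP s φ)
  subG s (φ ⊸ σ) = subP s φ ⊸ subG s σ

_[_]ᵀ : ∀ {k} → PTy (suc k) → PTy k → PTy k
φ [ ψ ]ᵀ = subP s φ
  where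
  s : Fin (suc _) → PTy _
  s zero = ψ
  s (suc i) = tvar i

data Tm (n : ℕ) : Set where
  var    : Fin n → Tm n
  unit   : Tm n
  stop   : Tm n → Tm n
  pair   : Tm n → Tm n → Tm n
  inl    : Tm n → Tm n
  inr    : Tm n → Tm n
  lam    : PTy 0 → Tm (suc n) → Tm n
  app    : Tm n → Tm n → Tm n
  case   : Tm n → Tm (suc n) → Tm (suc n) → Tm n
  prl    : Tm n → Tm n
  prr    : Tm n → Tm n
  go     : Tm n → Tm n
  fix    : GTy 0 → Tm (suc n) → Tm n
  fold   : Tm n → Tm n
  unfold : Tm n → Tm n
  coin   : (p : ℚ) → 0ℚ ≤ p → p ≤ 1ℚ → Tm n

ext : ∀ {n m} → (Fin n → Fin m) → Fin (suc n) → Fin (suc m)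
ext ρ zero = zero
ext ρ (suc i) = suc (ρ i)

ren : ∀ {n m} → (Fin n → Fin m) → Tm n → Tm m
ren ρ (var x) = var (ρ x)
ren ρ unit = unit
ren ρ (stop M) = stop (ren ρ M)
ren ρ (pair M N) = pair (ren ρ M) (ren ρ N)
ren ρ (inl M) = inl (ren ρ M)
ren ρ (inr M) = inr (ren ρ M)
ren ρ (lam φ M) = lam φ (ren (ext ρ) M)
ren ρ (app M N) = app (ren ρ M) (ren ρ N)
ren ρ (case M Nl Nr) = case (ren ρ M) (ren (ext ρ) Nl) (ren (ext ρ) Nr)
ren ρ (prl M) = prl (ren ρ M)
ren ρ (prr M) = prr (ren ρ M)
ren ρ (go M) = go (ren ρ M)
ren ρ (fix σ M) = fix σ (ren (ext ρ) M)
ren ρ (fold M) = fold (ren ρ M)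
ren ρ (unfold M) = unfold (ren ρ M)
ren ρ (coin p a b) = coin p a b

exts : ∀ {n m} → (Fin n → Tm m) → Fin (suc n) → Tm (suc m)
exts s zero = var zero
exts s (suc i) = ren suc (s i)

sub : ∀ {n m} → (Fin n → Tm m) → Tm n → Tm m
sub s (var x) = s x
sub s unit = unit
sub s (stop M) = stop (sub s M)
sub s (pair M N) = pair (sub s M) (sub s N)
sub s (inl M) = inl (sub s M)
sub s (inr M) = inr (sub s M)
sub s (lam φ M) = lam φ (sub (exts s) M)
sub s (app M N) = app (sub s M) (sub s N)
sub s (case M Nl Nr) = case (sub s M) (sub (exts s) Nl) (sub (exts s) Nr)
sub s (prl M) = prl (sub s M)
sub s (prr M) = prr (sub s M)
sub s (go M) = go (sub s M)
sub s (fix σ M) = fix σ (sub (exts s) M)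
sub s (fold M) = fold (sub s M)
sub s (unfold M) = unfold (sub s M)
sub s (coin p a b) = coin p a b

_[_] : ∀ {n} → Tm (suc n) → Tm n → Tm n
M [ V ] = sub s M
  where
  s : Fin (suc _) → Tm _
  s zero = V
  s (suc i) = var i

isVal : ∀ {n} → Tm n → Bool
isVal (var x) = true
isVal unit = true
isVal (stop M) = true
isVal (pair V W) = isVal V ∧ isVal W
isVal (inl V) = isVal V
isVal (inr V) = isVal V
isVal (fold V) = isVal V
isVal _ = false

Value : ∀ {n} → Tm n → Set
Value V = T (isVal V)

infix 4 _⊢_∶_
data _⊢_∶_ {n : ℕ} (Γ : Vec (PTy 0) n) : Tm n → GTy 0 → Set where
  t-var    : ∀ x → Γ ⊢ var x ∶ pos (lookup Γ x)
  t-unit   : Γ ⊢ unit ∶ pos one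
  t-stop   : ∀ {M σ} → Γ ⊢ M ∶ σ → Γ ⊢ stop M ∶ pos (bang σ)
  t-pair   : ∀ {M N φ ψ} → Γ ⊢ M ∶ pos φ → Γ ⊢ N ∶ pos ψ → Γ ⊢ pair M N ∶ pos (φ ⊗ ψ)
  t-inl    : ∀ {M φ ψ} → Γ ⊢ M ∶ pos φ → Γ ⊢ inl M ∶ pos (φ ⊕ ψ)
  t-inr    : ∀ {M φ ψ} → Γ ⊢ M ∶ pos ψ → Γ ⊢ inr M ∶ pos (φ ⊕ ψ)
  t-lam    : ∀ {M φ σ} → (φ ∷ Γ) ⊢ M ∶ σ → Γ ⊢ lam φ M ∶ (φ ⊸ σ)
  t-app    : ∀ {M N φ σ} → Γ ⊢ M ∶ (φ ⊸ σ) → Γ ⊢ N ∶ pos φ → Γ ⊢ app M N ∶ σ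
  t-case   : ∀ {M Nl Nr φl φr σ} → Γ ⊢ M ∶ pos (φl ⊕ φr) →
             (φl ∷ Γ) ⊢ Nl ∶ σ → (φr ∷ Γ) ⊢ Nr ∶ σ → Γ ⊢ case M Nl Nr ∶ σ
  t-prl    : ∀ {M φl φr} → Γ ⊢ M ∶ pos (φl ⊗ φr) → Γ ⊢ prl M ∶ pos φl
  t-prr    : ∀ {M φl φr} → Γ ⊢ M ∶ pos (φl ⊗ φr) → Γ ⊢ prr M ∶ pos φr
  t-go     : ∀ {M σ} → Γ ⊢ M ∶ pos (bang σ) → Γ ⊢ go M ∶ σ
  t-fix    : ∀ {M σ} → (bang σ ∷ Γ) ⊢ M ∶ σ → Γ ⊢ fix σ M ∶ σ
  t-fold   : ∀ {M φ} → Γ ⊢ M ∶ pos (φ [ mu φ ]ᵀ) → Γ ⊢ fold M ∶ pos (mu φ)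
  t-unfold : ∀ {M φ} → Γ ⊢ M ∶ pos (mu φ) → Γ ⊢ unfold M ∶ pos (φ [ mu φ ]ᵀ)
  t-coin   : ∀ {p a b} → Γ ⊢ coin p a b ∶ pos (one ⊕ one)

-- Weak reduction ⇝ (the axioms only, on closed terms)

infix 4 _⇝_
data _⇝_ : Tm 0 → Tm 0 → Set where
  go-stop     : ∀ {M} → go (stop M) ⇝ M
  beta        : ∀ {φ M V} → Value V → app (lam φ M) V ⇝ M [ V ]
  prl-pair    : ∀ {V W} → Value V → Value W → prl (pair V W) ⇝ V
  prr-pair    : ∀ {V W} → Value V → Value W → prr (pair V W) ⇝ W
  fix-unfold  : ∀ {σ M} → fix σ M ⇝ M [ stop (fix σ M) ]
  case-inl    : ∀ {V Nl Nr} → Value V → case (inl V) Nl Nr ⇝ Nl [ V ]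
  case-inr    : ∀ {V Nl Nr} → Value V → case (inr V) Nl Nr ⇝ Nr [ V ]
  unfold-fold : ∀ {V} → Value V → unfold (fold V) ⇝ V

-- Probabilistic reduction →_p as a function: step M lists all pairs (p , M')
-- with M →_p M' (nothing iff M is weak normal).

Dist : Set
Dist = List (ℚ × Tm 0)

maps : (Tm 0 → Tm 0) → Maybe Dist → Maybe Dist
maps f = Maybe.map (map (λ { (p , t) → (p , f t) }))

step : Tm 0 → Maybe Dist
step (var ())
step unit = nothing
step (stop M) = nothing
step (pair M N) with step M
... | just d = just (map (λ { (p , t) → (p , pair t N) }) d)
... | nothing = if isVal M then maps (pair M) (step N) else nothing
step (inl M) = maps inl (step M)
step (inr M) = maps inr (step M)
step (lam φ M) = nothing
step (app (lam φ B) N) =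
  if isVal N then just ((1ℚ , B [ N ]) ∷ []) else maps (app (lam φ B)) (step N)
step (app M N) =
  if isVal N then maps (λ t → app t N) (step M) else maps (app M) (step N)
step (case (inl V) Nl Nr) =
  if isVal V then just ((1ℚ , Nl [ V ]) ∷ []) else maps (λ t → case t Nl Nr) (step (inl V))
step (case (inr V) Nl Nr) =
  if isVal V then just ((1ℚ , Nr [ V ]) ∷ []) else maps (λ t → case t Nl Nr) (step (inr V))
step (case M Nl Nr) = maps (λ t → case t Nl Nr) (step M)
step (prl (pair V W)) =
  if isVal V ∧ isVal W then just ((1ℚ , V) ∷ []) else maps prl (step (pair V W))
step (prl M) = maps prl (step M)
step (prr (pair V W)) =
  if isVal V ∧ isVal W then just ((1ℚ , W) ∷ []) else maps prr (step (pair V W))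
step (prr M) = maps prr (step M)
step (go (stop M)) = just ((1ℚ , M) ∷ [])
step (go M) = maps go (step M)
step (fix σ M) = just ((1ℚ , M [ stop (fix σ M) ]) ∷ [])
step (fold M) = maps fold (step M)
step (unfold (fold V)) =
  if isVal V then just ((1ℚ , V) ∷ []) else maps unfold (step (fold V))
step (unfold M) = maps unfold (step M)
step (coin p a b) = just ((p , inl unit) ∷ (1ℚ - p , inr unit) ∷ [])

-- Row M of the matrix Red: Red_{M,M'} = p if M →_p M'; Red_{M,M} = 1 if M weak normal
redRow : Tm 0 → Dist
redRow M = fromMaybe ((1ℚ , M) ∷ []) (step M)

-- Row M of Red^n (as a finite list of weighted terms; weights of equal terms add up)
redPowRow : ℕ → Tm 0 → Dist
redPowRow zero M = (1ℚ , M) ∷ []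
redPowRow (suc n) M =
  concatMap (λ { (p , M') → map (λ { (q , N) → (p * q , N) }) (redPowRow n M') }) (redRow M)

isUnit : Tm 0 → Bool
isUnit unit = true
isUnit _ = false

RedPowUnit : ℕ → Tm 0 → ℚ
RedPowUnit n M =
  foldr (λ { (p , N) acc → if isUnit N then p + acc else acc }) 0ℚ (redPowRow n M)

-- Equality of suprema  sup_n a n = sup_n b n  (of sequences of rationals),
-- stated without real numbers: every a n is ≤ sup b and vice versa.

SupLe : (ℕ → ℚ) → (ℕ → ℚ) → Set
SupLe a b = ∀ n (ε : ℚ) → 0ℚ < ε → ∃[ m ] (a n ≤ b m + ε)

SupEq : (ℕ → ℚ) → (ℕ → ℚ) → Set
SupEq a b = SupLe a b × SupLe b a

-- Red^∞_{M,()} = Red^∞_{M',()}   (() is weak normal, so Red^∞_{M,()} = sup_n (Red^n)_{M,()})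
RedInfUnitEq : Tm 0 → Tm 0 → Set
RedInfUnitEq M M' = SupEq (λ n → RedPowUnit n M) (λ n → RedPowUnit n M')

-- A deterministic redex M ⇝ M' has M' as its only reduct, with probability 1,
-- so Red^(n+1)_{M,()} = Red^n_{M',()}; and Red^0_{M,()} = 0 because a redex is
-- not (). The sequence for M is thus the one for M' preceded by 0, and both have
-- the same supremum.
module Submission where

open import Defs
open import Data.Vec using ([])
open import Data.Nat using (ℕ; zero; suc)
open import Data.List using ([]; _∷_; map; _++_; foldr)
open import Data.List.Properties using (map-cong; map-id; ++-identityʳ)
open import Data.Maybe using (just)
open import Data.Bool using (true; false)
open import Data.Product using (_,_; ∃-syntax)
open import Data.Rational using (ℚ; 0ℚ; 1ℚ; _+_; _≤_; _≤?_)
open import Data.Rational.Properties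
  using (*-identityˡ; +-identityʳ; +-monoʳ-≤; ≤-refl; ≤-reflexive; ≤-trans; <⇒≤)
open import Relation.Binary.PropositionalEquality
open import Relation.Nullary.Decidable using (toWitness)
open import Data.Unit using (tt)
open import Function using (id)

p≤p+q : ∀ p {q} → 0ℚ ≤ q → p ≤ p + q
p≤p+q p 0≤q = subst (_≤ p + _) (+-identityʳ p) (+-monoʳ-≤ p 0≤q)

SupLe-dominated : ∀ {a b : ℕ → ℚ} → (∀ n → ∃[ m ] a n ≤ b m) → SupLe a b
SupLe-dominated dom n ε 0<ε with dom n
... | m , aₙ≤bₘ = m , ≤-trans aₙ≤bₘ (p≤p+q _ (<⇒≤ 0<ε))

SupEq-shift : ∀ {a b : ℕ → ℚ} → a 0 ≤ b 0 → (∀ n → a (suc n) ≡ b n) → SupEq a b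
SupEq-shift {a} {b} a₀≤b₀ shift = SupLe-dominated left , SupLe-dominated right
  where
  left : ∀ n → ∃[ m ] a n ≤ b m
  left zero = 0 , a₀≤b₀
  left (suc n) = n , ≤-reflexive (shift n)

  right : ∀ n → ∃[ m ] b n ≤ a m
  right n = suc n , ≤-reflexive (sym (shift n))

step-⇝ : ∀ {M M'} → M ⇝ M' → step M ≡ just ((1ℚ , M') ∷ [])
step-⇝ go-stop = refl
step-⇝ (beta {V = V} _) with isVal V
... | true = refl
step-⇝ (prl-pair {V} {W} _ _) with isVal V | isVal W
... | true | true = refl
step-⇝ (prr-pair {V} {W} _ _) with isVal V | isVal W
... | true | true = refl
step-⇝ fix-unfold = refl
step-⇝ (case-inl {V} _) with isVal V
... | true = refl
step-⇝ (case-inr {V} _) with isVal V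
... | true = refl
step-⇝ (unfold-fold {V} _) with isVal V
... | true = refl

redPowRow-suc-⇝ : ∀ {M M'} → M ⇝ M' → ∀ n → redPowRow (suc n) M ≡ redPowRow n M'
redPowRow-suc-⇝ {M' = M'} r n rewrite step-⇝ r = begin
  map _ (redPowRow n M') ++ [] ≡⟨ ++-identityʳ _ ⟩
  map _ (redPowRow n M')       ≡⟨ map-cong (λ { (q , N) → cong (_, N) (*-identityˡ q) }) _ ⟩
  map id (redPowRow n M')      ≡⟨ map-id _ ⟩
  redPowRow n M'               ∎
  where open ≡-Reasoning

RedPowUnit-suc-⇝ : ∀ {M M'} → M ⇝ M' → ∀ n → RedPowUnit (suc n) M ≡ RedPowUnit n M'
RedPowUnit-suc-⇝ r n = cong (foldr _ 0ℚ) (redPowRow-suc-⇝ r n)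

RedPowUnit-zero-⇝ : ∀ {M M'} → M ⇝ M' → RedPowUnit 0 M ≡ 0ℚ
RedPowUnit-zero-⇝ go-stop = refl
RedPowUnit-zero-⇝ (beta _) = refl
RedPowUnit-zero-⇝ (prl-pair _ _) = refl
RedPowUnit-zero-⇝ (prr-pair _ _) = refl
RedPowUnit-zero-⇝ fix-unfold = refl
RedPowUnit-zero-⇝ (case-inl _) = refl
RedPowUnit-zero-⇝ (case-inr _) = refl
RedPowUnit-zero-⇝ (unfold-fold _) = refl

RedPowUnit-zero-nonNeg : ∀ N → 0ℚ ≤ RedPowUnit 0 N
RedPowUnit-zero-nonNeg N with isUnit N
... | true = toWitness {a? = 0ℚ ≤? 1ℚ + 0ℚ} tt
... | false = ≤-refl

lemma4p3 : (M M' : Tm 0) → [] ⊢ M ∶ pos one → [] ⊢ M' ∶ pos one →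
    M ⇝ M' → RedInfUnitEq M M'
lemma4p3 M M' _ _ r = SupEq-shift red₀≤red₀' (RedPowUnit-suc-⇝ r)
  where
  red₀≤red₀' : RedPowUnit 0 M ≤ RedPowUnit 0 M'
  red₀≤red₀' = subst (_≤ RedPowUnit 0 M') (sym (RedPowUnit-zero-⇝ r)) (RedPowUnit-zero-nonNeg M')
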